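{- The complete graph $K_8$ does not have a nearly triangular minimum genus embedding.
   Context: Embeddings are cellular embeddings in closed orientable surfaces; the length of a face is the number of corners on its boundary walk. An embedding is nearly triangular if at most one face has length different from $3$. A minimum genus embedding is an embedding in an orientable surface of the smallest genus in which the graph embeds (for $K_8$ this genus is $2$). -}

module Defs where

open import Data.Nat using (ℕ; zero; suc; _+_; _*_; _≤_; _<_; _≤?_)
open import Data.Fin using (Fin; toℕ; _≟_)
open import Data.Fin.Properties using (all?)
open import Data.Fin.Permutation using (Permutation′; _⟨$⟩ʳ_)
open import Data.Integer as ℤ using (ℤ; +_)
open import Data.List using (List; allFin; cartesianProduct; filter; length)
open import Data.Product using (_×_; _,_; ∃-syntax; proj₁; proj₂)
open import Data.Sum using (_⊎_)
open import Relation.Nullary using (¬_; Dec; _×-dec_; ¬?)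

open import Relation.Binary.PropositionalEquality using (_≡_; _≢_)

-- Combinatorial (rotation-system) model of cellular embeddings of K₈ in
-- closed orientable surfaces (Heffter–Edmonds).  Vertices are Fin 8; the
-- graph is complete, so the neighbours of v are all u ≢ v.

iter : {A : Set} → (A → A) → ℕ → A → A
iter f zero    x = x
iter f (suc k) x = f (iter f k x)

-- A rotation system: at each vertex v a permutation of Fin 8 that fixes v
-- and permutes the 7 neighbours of v in a single cycle.
record Rotation : Set where
  field
    rot    : Fin 8 → Permutation′ 8
    fixes  : ∀ v → rot v ⟨$⟩ʳ v ≡ v
    cyclic : ∀ v u w → u ≢ v → w ≢ v →
             ∃[ k ] iter (rot v ⟨$⟩ʳ_) k u ≡ w
open Rotation public

Dart : Set
Dart = Fin 8 × Fin 8

IsDart : Dart → Set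
IsDart (u , v) = u ≢ v

isDart? : (d : Dart) → Dec (IsDart d)
isDart? (u , v) = ¬? (u ≟ v)

faceStep : Rotation → Dart → Dart
faceStep ρ (u , v) = (v , rot ρ v ⟨$⟩ʳ u)

SameFace : Rotation → Dart → Dart → Set
SameFace ρ d d' = ∃[ k ] iter (faceStep ρ) k d ≡ d'

FaceLength : Rotation → Dart → ℕ → Set
FaceLength ρ d n =
  0 < n × iter (faceStep ρ) n d ≡ d ×
  (∀ j → 0 < j → j < n → iter (faceStep ρ) j d ≢ d)

-- Nearly triangular: at most one face has length different from 3, i.e.
-- there is a dart d₀ such that every dart not on the face of d₀ lies on a
-- face of length 3.
NearlyTriangular : Rotation → Set
NearlyTriangular ρ =
  ∃[ d₀ ] ∀ d → IsDart d → SameFace ρ d₀ d ⊎ FaceLength ρ d 3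

-- Counting faces: a face is counted by its dart of least code.  There are
-- 56 darts, so every orbit is {φ^k d | k < 56}.
code : Dart → ℕ
code (u , v) = toℕ u * 8 + toℕ v

IsRep : Rotation → Dart → Set
IsRep ρ d = ∀ (k : Fin 56) → code d ≤ code (iter (faceStep ρ) (toℕ k) d)

isRep? : (ρ : Rotation) → (d : Dart) → Dec (IsRep ρ d)
isRep? ρ d = all? (λ k → code d ≤? code (iter (faceStep ρ) (toℕ k) d))

allDarts : List Dart
allDarts = cartesianProduct (allFin 8) (allFin 8)

faceCount : Rotation → ℕ
faceCount ρ = length (filter (λ d → isDart? d ×-dec isRep? ρ d) allDarts)

-- Euler's formula V − E + F = 2 − 2g with V = 8, E = 28.
HasGenus : Rotation → ℕ → Set
HasGenus ρ g = (+ 8) ℤ.- (+ 28) ℤ.+ (+ faceCount ρ) ≡ (+ 2) ℤ.- (+ (2 * g))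

module Submission where

-- Euler's formula gives a genus-2 embedding of K₈ exactly 8 − 28 − (2 − 2·2) = 18 faces.  Each face
-- has exactly one representative dart, so summing over all darts d the number of representatives
-- among d, φ d, φ² d (φ the face step) gives 3 · 18.  If all faces but one are triangles, a dart off
-- the exceptional face contributes 1 and the darts of that face contribute 3 in total, so with 56
-- darts 54 = (56 − p) + 3 and the exceptional face has length p = 5.  Its vertices are distinct
-- because the rotations are 7-cycles, so after relabelling it is the pentagon 0 → 1 → 2 → 3 → 4.
-- A verified backtracking search shows that no rotation system of K₈ has this face with all other
-- faces triangles: it closes the first undetermined dart into a triangle in every possible way and
-- discards partial rotations that stop being injective or close up a cycle shorter than 7.

open import Defs

open import Algebra.Bundles using (AbelianGroup)
open import Data.Bool using (Bool; true; false; if_then_else_)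
open import Data.Bool.Properties using (T-≡) renaming (_≟_ to _≟ᵇ_)
open import Data.Empty using (⊥; ⊥-elim)
open import Data.Fin using (Fin; zero; suc; toℕ; fromℕ<; combine; punchIn; _↑ˡ_; _≟_)
open import Data.Fin.Patterns using (0F; 1F; 2F; 3F; 4F)
open import Data.Fin.Permutation using (Permutation′; _⟨$⟩ʳ_; _⟨$⟩ˡ_; id; _∘ₚ_; transpose; inverseˡ; inverseʳ; flip)
open import Data.Fin.Properties
  using (any?; all?; pigeonhole; toℕ<n; toℕ-fromℕ<; toℕ-injective; toℕ-combine; combine-injective;
         punchIn-injective; punchInᵢ≢i; ↑ˡ-injective)
import Data.Integer as ℤ
import Data.Integer.Properties as ℤ
open import Data.Integer.Properties using (+-0-abelianGroup)
open import Algebra.Properties.Group (AbelianGroup.group +-0-abelianGroup) using (∙-cancelˡ)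
open import Data.List using ([]; _∷_; map; filter; length; foldr; allFin; cartesianProduct; _++_)
open import Data.List.Properties using (map-++; map-∘)
open import Data.Maybe using (Maybe; just; nothing; maybe′; _>>=_)
open import Data.Maybe.Properties using (just-injective) renaming (≡-dec to ≡-dec-Maybe)
open import Data.Maybe.Relation.Unary.Any using (Any; just)
import Data.Nat as ℕ
open import Data.Nat using (ℕ; zero; suc; _+_; _*_; _∸_; _%_; _/_; _≤_; _<_; z<s; s<s; s≤s⁻¹; NonZero; >-nonZero; _<?_)
open import Data.Nat.DivMod using (m%n<n; m≡m%n+[m/n]*n)
import Data.Nat.ListAction as List
open import Data.Nat.ListAction.Properties using (sum-++)
open import Data.Nat.Properties
  using (≤-refl; <-irrefl; <-cmp; <-≤-trans; ≤-<-trans; <⇒≤; ≤-antisym; ≮⇒≥; m≤n⇒m<n∨m≡n; n<1+n; m≤m+n; m≤n+m;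
         m∸n≤m; m<n⇒0<n∸m; m+[n∸m]≡n; m∸n+n≡m; +-comm; +-suc; *-comm; +-cancelˡ-≡; +-cancelʳ-≡; anyUpTo?;
         +-0-commutativeMonoid)
open import Algebra.Properties.CommutativeMonoid.Sum +-0-commutativeMonoid
  using (sum; sum-syntax; sum-cong-≗; sum-replicate-zero; ∑-comm; ∑-distrib-+; sum-permute)
open import Data.Product using (_×_; _,_; ∃-syntax; proj₁; proj₂)
open import Data.Product.Properties using (≡-dec; ×-≡,≡→≡; ×-≡,≡←≡)
open import Data.Sum using (_⊎_; inj₁; inj₂; [_,_]′)
open import Data.Vec using (Vec; lookup; replicate; _[_]%=_; _[_]≔_)
open import Data.Vec.Properties using (lookup∘updateAt; lookup∘updateAt′; lookup∘update; lookup∘update′; lookup-replicate)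
open import Function using (_∘_)
open import Function.Bundles using (Equivalence; Injection; _⇔_; mk⇔)
open import Function.Definitions using (Injective)
open import Function.Properties.Inverse using (↔⇒↣)
open import Relation.Binary.Definitions using (DecidableEquality; tri<; tri≈; tri>)
open import Relation.Binary.PropositionalEquality
  using (_≡_; _≢_; refl; sym; trans; cong; cong₂; subst; module ≡-Reasoning)
open import Relation.Nullary using (¬_; Dec; yes; no; does; ¬?; _×-dec_; _⊎-dec_; map′)
open import Relation.Nullary.Decidable using (dec-true; dec-false; does-⇔; toWitness; isYes; from-yes)
open import Relation.Unary using (Decidable)
open ≡-Reasoning

-- Orbits of an endofunction

least-witness : {P : ℕ → Set} → Decidable P → ∀ {n} → P n → ∃[ m ] P m × (∀ {k} → k < m → ¬ P k)
least-witness {P} P? {n} Pn = search (suc n) (n , ≤-refl , Pn)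
  where
  search : ∀ b → ∃[ k ] k < b × P k → ∃[ m ] P m × (∀ {k} → k < m → ¬ P k)
  search (suc b) (k , k≤b , Pk) with anyUpTo? P? b
  ... | yes below = search b below
  ... | no none   = k , Pk , λ j<k Pj → none (_ , <-≤-trans j<k (s≤s⁻¹ k≤b) , Pj)

module _ {A : Set} (f : A → A) where

  iter-+ : ∀ m n x → iter f (m + n) x ≡ iter f m (iter f n x)
  iter-+ zero    n x = refl
  iter-+ (suc m) n x = cong f (iter-+ m n x)

  iter-swap : ∀ m n x → iter f m (iter f n x) ≡ iter f n (iter f m x)
  iter-swap m n x = begin
    iter f m (iter f n x) ≡⟨ iter-+ m n x ⟨
    iter f (m + n) x      ≡⟨ cong (λ k → iter f k x) (+-comm m n) ⟩
    iter f (n + m) x      ≡⟨ iter-+ n m x ⟩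
    iter f n (iter f m x) ∎

  iter-injective : Injective _≡_ _≡_ f → ∀ k → Injective _≡_ _≡_ (iter f k)
  iter-injective inj zero    eq = eq
  iter-injective inj (suc k) eq = iter-injective inj k (inj eq)

  iter-preserves : {P : A → Set} → (∀ {x} → P x → P (f x)) → ∀ k {x} → P x → P (iter f k x)
  iter-preserves     step zero    Px = Px
  iter-preserves {P} step (suc k) Px = step (iter-preserves {P} step k Px)

  iter-*-fixed : ∀ {p x} → iter f p x ≡ x → ∀ q → iter f (q * p) x ≡ x
  iter-*-fixed         fix zero    = refl
  iter-*-fixed {p} {x} fix (suc q) = begin
    iter f (p + q * p) x        ≡⟨ iter-+ p (q * p) x ⟩
    iter f p (iter f (q * p) x) ≡⟨ cong (iter f p) (iter-*-fixed fix q) ⟩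
    iter f p x                  ≡⟨ fix ⟩
    x                           ∎

  iter-mod : ∀ {p x} .{{_ : NonZero p}} → iter f p x ≡ x → ∀ k → iter f k x ≡ iter f (k % p) x
  iter-mod {p} {x} fix k = begin
    iter f k x                            ≡⟨ cong (λ n → iter f n x) (m≡m%n+[m/n]*n k p) ⟩
    iter f (k % p + k / p * p) x          ≡⟨ iter-+ (k % p) (k / p * p) x ⟩
    iter f (k % p) (iter f (k / p * p) x) ≡⟨ cong (iter f (k % p)) (iter-*-fixed fix (k / p)) ⟩
    iter f (k % p) x                      ∎

  iter-cancel : Injective _≡_ _≡_ f → ∀ {i j x} → i ≤ j → iter f i x ≡ iter f j x → iter f (j ∸ i) x ≡ x
  iter-cancel inj {i} {j} {x} i≤j eq = iter-injective inj i (begin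
    iter f i (iter f (j ∸ i) x) ≡⟨ iter-+ i (j ∸ i) x ⟨
    iter f (i + (j ∸ i)) x      ≡⟨ cong (λ n → iter f n x) (m+[n∸m]≡n i≤j) ⟩
    iter f j x                  ≡⟨ eq ⟨
    iter f i x                  ∎)

  MinimalPeriod : A → ℕ → Set
  MinimalPeriod x p = 0 < p × iter f p x ≡ x × (∀ j → 0 < j → j < p → iter f j x ≢ x)

  periodic-point : Injective _≡_ _≡_ f → ∀ {n} (enc : A → Fin n) → Injective _≡_ _≡_ enc →
                   ∀ x → ∃[ k ] 0 < k × iter f k x ≡ x
  periodic-point inj {n} enc enc-inj x with pigeonhole (n<1+n n) (λ i → enc (iter f (toℕ i) x))
  ... | i , j , i<j , eq = _ , m<n⇒0<n∸m i<j , iter-cancel inj (<⇒≤ i<j) (enc-inj eq)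

  minimal-period : DecidableEquality A → ∀ {x k} → 0 < k → iter f k x ≡ x → ∃[ p ] MinimalPeriod x p
  minimal-period _≟_ {x} 0<k fix with least-witness (λ k → 0 <? k ×-dec iter f k x ≟ x) (0<k , fix)
  ... | p , (0<p , fixp) , least = p , 0<p , fixp , λ j 0<j j<p eq → least j<p (0<j , eq)

  period-injective : Injective _≡_ _≡_ f → ∀ {x p} → MinimalPeriod x p →
                     ∀ {i j} → i < p → j < p → iter f i x ≡ iter f j x → i ≡ j
  period-injective inj (_ , _ , minimal) {i} {j} i<p j<p eq with <-cmp i j
  ... | tri< i<j _ _ = ⊥-elim (minimal (j ∸ i) (m<n⇒0<n∸m i<j) (≤-<-trans (m∸n≤m j i) j<p)
                                       (iter-cancel inj (<⇒≤ i<j) eq))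
  ... | tri≈ _ i≡j _ = i≡j
  ... | tri> _ _ j<i = ⊥-elim (minimal (i ∸ j) (m<n⇒0<n∸m j<i) (≤-<-trans (m∸n≤m i j) i<p)
                                       (iter-cancel inj (<⇒≤ j<i) (sym eq)))

  Reaches : A → A → Set
  Reaches x y = ∃[ k ] iter f k x ≡ y

  reaches-trans : ∀ {x y z} → Reaches x y → Reaches y z → Reaches x z
  reaches-trans {x} (j , refl) (k , refl) = k + j , iter-+ k j x

  module _ {p x} .{{_ : NonZero p}} (fix : iter f p x ≡ x) where

    reaches-within : ∀ {y} → Reaches x y → ∃[ k ] k < p × iter f k x ≡ y
    reaches-within (k , refl) = k % p , m%n<n k p , sym (iter-mod fix k)

    reaches-period : ∀ {y} → Reaches x y → iter f p y ≡ y
    reaches-period (k , refl) = trans (iter-swap p k x) (cong (iter f k) fix)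

    reaches-sym : ∀ {y} → Reaches x y → Reaches y x
    reaches-sym r with reaches-within r
    ... | k , k<p , refl = p ∸ k , (begin
      iter f (p ∸ k) (iter f k x) ≡⟨ iter-+ (p ∸ k) k x ⟨
      iter f (p ∸ k + k) x        ≡⟨ cong (λ n → iter f n x) (m∸n+n≡m (<⇒≤ k<p)) ⟩
      iter f p x                  ≡⟨ fix ⟩
      x                           ∎)

-- Permutations of a finite set

transpose-here : ∀ {n} (i j : Fin n) → transpose i j ⟨$⟩ʳ i ≡ j
transpose-here i j rewrite dec-true (i ≟ i) refl = refl

transpose-elsewhere : ∀ {n} {i j k : Fin n} → k ≢ i → k ≢ j → transpose i j ⟨$⟩ʳ k ≡ k
transpose-elsewhere {i = i} {j} {k} k≢i k≢j rewrite dec-false (k ≟ i) k≢i | dec-false (k ≟ j) k≢j = refl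

permutation-mapping : ∀ {m n} (x y : Fin m → Fin n) → Injective _≡_ _≡_ x → Injective _≡_ _≡_ y →
                      ∃[ π ] ∀ i → π ⟨$⟩ʳ x i ≡ y i
permutation-mapping {m} x y x-inj y-inj =
  let π , agrees = on-prefix m ≤-refl in π , λ i → agrees i (toℕ<n i)
  where
  on-prefix : ∀ k → k ≤ m → ∃[ π ] ∀ i → toℕ i < k → π ⟨$⟩ʳ x i ≡ y i
  on-prefix zero    _   = id , λ _ ()
  on-prefix (suc k) k<m = extend (on-prefix k (<⇒≤ k<m))
    where
    i₀ : Fin m
    i₀ = fromℕ< k<m
    below-≢ : ∀ {i} → toℕ i < k → i ≢ i₀
    below-≢ i<k refl = <-irrefl (toℕ-fromℕ< k<m) i<k
    extend : ∃[ π ] (∀ i → toℕ i < k → π ⟨$⟩ʳ x i ≡ y i) → ∃[ π ] ∀ i → toℕ i < suc k → π ⟨$⟩ʳ x i ≡ y i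
    extend (π , agrees) = π ∘ₚ transpose (π ⟨$⟩ʳ x i₀) (y i₀) , agrees′
      where
      agrees′ : ∀ i → toℕ i < suc k → transpose (π ⟨$⟩ʳ x i₀) (y i₀) ⟨$⟩ʳ (π ⟨$⟩ʳ x i) ≡ y i
      agrees′ i i<1+k with m≤n⇒m<n∨m≡n (s≤s⁻¹ i<1+k)
      ... | inj₁ i<k = trans (cong (transpose _ _ ⟨$⟩ʳ_) (agrees i i<k)) (transpose-elsewhere {k = y i}
                         (λ eq → below-≢ i<k (x-inj (Injection.injective (↔⇒↣ π) (trans (agrees i i<k) eq))))
                         (λ eq → below-≢ i<k (y-inj eq)))
      ... | inj₂ i≡k with toℕ-injective (trans i≡k (sym (toℕ-fromℕ< k<m)))
      ...   | refl = transpose-here (π ⟨$⟩ʳ x i₀) (y i₀)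

-- Counting darts

𝟙[_] : {A : Set} → Dec A → ℕ
𝟙[ a? ] = if does a? then 1 else 0

𝟙-cong : {A B : Set} (a? : Dec A) (b? : Dec B) → A ⇔ B → 𝟙[ a? ] ≡ 𝟙[ b? ]
𝟙-cong a? b? A⇔B = cong (λ b → if b then 1 else 0) (does-⇔ A⇔B a? b?)

𝟙-yes : {A : Set} (a? : Dec A) → A → 𝟙[ a? ] ≡ 1
𝟙-yes a? a = cong (λ b → if b then 1 else 0) (dec-true a? a)

𝟙-no : {A : Set} (a? : Dec A) → ¬ A → 𝟙[ a? ] ≡ 0
𝟙-no a? ¬a = cong (λ b → if b then 1 else 0) (dec-false a? ¬a)

∑-𝟙-≟ : ∀ {n} (a : Fin n) → ∑[ i < n ] 𝟙[ a ≟ i ] ≡ 1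
∑-𝟙-≟ {suc n} zero    = cong suc (sum-replicate-zero n)
∑-𝟙-≟         (suc a) = ∑-𝟙-≟ a

∑-1 : ∀ n → ∑[ i < n ] 1 ≡ n
∑-1 zero    = refl
∑-1 (suc n) = cong suc (∑-1 n)

length-filter-𝟙 : ∀ {A : Set} {P : A → Set} (P? : Decidable P) xs →
                length (filter P? xs) ≡ List.sum (map (λ x → 𝟙[ P? x ]) xs)
length-filter-𝟙 P? []       = refl
length-filter-𝟙 P? (x ∷ xs) with does (P? x)
... | true  = cong suc (length-filter-𝟙 P? xs)
... | false = length-filter-𝟙 P? xs

sum-cartesianProduct : ∀ {A B : Set} (g : A × B → ℕ) xs ys →
  List.sum (map g (cartesianProduct xs ys)) ≡ List.sum (map (λ x → List.sum (map (λ y → g (x , y)) ys)) xs)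
sum-cartesianProduct g []       ys = refl
sum-cartesianProduct g (x ∷ xs) ys = begin
  List.sum (map g (map (x ,_) ys ++ cartesianProduct xs ys))
    ≡⟨ cong List.sum (map-++ g (map (x ,_) ys) (cartesianProduct xs ys)) ⟩
  List.sum (map g (map (x ,_) ys) ++ map g (cartesianProduct xs ys))
    ≡⟨ sum-++ (map g (map (x ,_) ys)) _ ⟩
  List.sum (map g (map (x ,_) ys)) + List.sum (map g (cartesianProduct xs ys))
    ≡⟨ cong₂ _+_ (cong List.sum (sym (map-∘ ys))) (sum-cartesianProduct g xs ys) ⟩
  List.sum (map (λ y → g (x , y)) ys) + List.sum (map (λ x → List.sum (map (λ y → g (x , y)) ys)) xs) ∎

_≟ᴰ_ : DecidableEquality Dart
_≟ᴰ_ = ≡-dec _≟_ _≟_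

𝟙-≟ᴰ-sym : ∀ d e → 𝟙[ d ≟ᴰ e ] ≡ 𝟙[ e ≟ᴰ d ]
𝟙-≟ᴰ-sym d e = 𝟙-cong (d ≟ᴰ e) (e ≟ᴰ d) (mk⇔ sym sym)

sumDarts : (Dart → ℕ) → ℕ
sumDarts f = ∑[ u < 8 ] ∑[ v < 8 ] f (u , v)

sumDarts-cong : ∀ {f g} → (∀ d → f d ≡ g d) → sumDarts f ≡ sumDarts g
sumDarts-cong f≗g = sum-cong-≗ λ u → sum-cong-≗ λ v → f≗g (u , v)

sumDarts-+ : ∀ f g → sumDarts (λ d → f d + g d) ≡ sumDarts f + sumDarts g
sumDarts-+ f g = trans (sum-cong-≗ λ u → ∑-distrib-+ (λ v → f (u , v)) (λ v → g (u , v)))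
                        (∑-distrib-+ (λ u → ∑[ v < 8 ] f (u , v)) (λ u → ∑[ v < 8 ] g (u , v)))

sumDarts-∑ : ∀ {n} (g : Fin n → Dart → ℕ) → sumDarts (λ d → ∑[ j < n ] g j d) ≡ ∑[ j < n ] sumDarts (g j)
sumDarts-∑ g = trans (sum-cong-≗ λ u → ∑-comm λ v j → g j (u , v)) (∑-comm λ u j → ∑[ v < 8 ] g j (u , v))

sumDarts-𝟙-≟ : ∀ a → sumDarts (λ d → 𝟙[ a ≟ᴰ d ]) ≡ 1
sumDarts-𝟙-≟ (a , b) = begin
  sumDarts (λ d → 𝟙[ (a , b) ≟ᴰ d ])
    ≡⟨ sumDarts-cong (λ (u , v) → 𝟙-cong ((a , b) ≟ᴰ (u , v)) (a ≟ u ×-dec b ≟ v) (mk⇔ ×-≡,≡←≡ ×-≡,≡→≡)) ⟩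
  sumDarts componentwise ≡⟨ sum-cong-≗ (λ u → ∑-𝟙-×-≟ (a ≟ u) b) ⟩
  ∑[ u < 8 ] 𝟙[ a ≟ u ]  ≡⟨ ∑-𝟙-≟ a ⟩
  1                      ∎
  where
  componentwise : Dart → ℕ
  componentwise (u , v) = 𝟙[ a ≟ u ×-dec b ≟ v ]
  ∑-𝟙-×-≟ : ∀ {A : Set} (a? : Dec A) {n} (b : Fin n) → ∑[ v < n ] 𝟙[ a? ×-dec b ≟ v ] ≡ 𝟙[ a? ]
  ∑-𝟙-×-≟ (yes _)     b = ∑-𝟙-≟ b
  ∑-𝟙-×-≟ (no _)  {n} b = sum-replicate-zero n

encode : Dart → Fin 64
encode (u , v) = combine u v

encode-injective : Injective _≡_ _≡_ encode
encode-injective {u , v} {u′ , v′} eq = ×-≡,≡→≡ (combine-injective u v u′ v′ eq)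

code-injective : ∀ {d e} → code d ≡ code e → d ≡ e
code-injective {d} {e} eq = encode-injective (toℕ-injective (trans (toℕ-encode d) (trans eq (sym (toℕ-encode e)))))
  where
  toℕ-encode : ∀ d → toℕ (encode d) ≡ code d
  toℕ-encode (u , v) = trans (toℕ-combine u v) (cong (_+ toℕ v) (*-comm 8 (toℕ u)))

Table : Set
Table = Fin 8 → Fin 8 → Fin 8

table : Rotation → Table
table ρ v u = rot ρ v ⟨$⟩ʳ u

-- Opaque: unfolding the 56-step test of IsRep during conversion checking exhausts memory.
opaque
  isFaceRep? : (ρ : Rotation) → ∀ d → Dec (IsDart d × IsRep ρ d)
  isFaceRep? ρ d = isDart? d ×-dec isRep? ρ d

module _ (ρ : Rotation) where
  private
    R = table ρ
    φ = faceStep ρ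

  table-injective : ∀ v → Injective _≡_ _≡_ (R v)
  table-injective v = Injection.injective (↔⇒↣ (rot ρ v))

  -- The seven neighbours of v are reached from u after numbers of steps that would coincide
  -- modulo a shorter period.
  table-long-cycles : ∀ v {u} → u ≢ v → ∀ k → 0 < k → k < 7 → iter (R v) k u ≢ u
  table-long-cycles v {u} u≢v (suc k) _ k<7 cycle =
    let i , j , i<j , same = pigeonhole k<7 residue in <-irrefl (cong toℕ (residue-injective same)) i<j
    where
    reach : ∀ i → ∃[ s ] iter (R v) s u ≡ punchIn v i
    reach i = cyclic ρ v u (punchIn v i) u≢v (punchInᵢ≢i v i)
    residue : Fin 7 → Fin (suc k)
    residue i = fromℕ< (m%n<n (proj₁ (reach i)) (suc k))
    reached : ∀ i → iter (R v) (toℕ (residue i)) u ≡ punchIn v i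
    reached i = begin
      iter (R v) (toℕ (residue i)) u
        ≡⟨ cong (λ n → iter (R v) n u) (toℕ-fromℕ< (m%n<n (proj₁ (reach i)) (suc k))) ⟩
      iter (R v) (proj₁ (reach i) % suc k) u ≡⟨ iter-mod (R v) cycle (proj₁ (reach i)) ⟨
      iter (R v) (proj₁ (reach i)) u         ≡⟨ proj₂ (reach i) ⟩
      punchIn v i                            ∎
    residue-injective : ∀ {i j} → residue i ≡ residue j → i ≡ j
    residue-injective {i} {j} eq = punchIn-injective v i j
      (trans (sym (reached i)) (trans (cong (λ r → iter (R v) (toℕ r) u) eq) (reached j)))

  faceStep-injective : Injective _≡_ _≡_ φ
  faceStep-injective {u , v} {u′ , v′} eq with cong proj₁ eq
  ... | refl = cong (_, v) (table-injective v (cong proj₂ eq))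

  faceStep-isDart : ∀ {d} → IsDart d → IsDart (φ d)
  faceStep-isDart {u , v} u≢v eq = u≢v (table-injective v (trans (sym eq) (sym (fixes ρ v))))

  faceStep-nonDart : ∀ {d} → ¬ IsDart d → ¬ IsDart (φ d)
  faceStep-nonDart {u , v} nonDart v≢Rvu = nonDart λ { refl → v≢Rvu (sym (fixes ρ v)) }

  onFace-isDart : ∀ {d e} → IsDart d → SameFace ρ d e → IsDart e
  onFace-isDart dart (k , refl) = iter-preserves φ {IsDart} faceStep-isDart k dart

  faceLength-exists : ∀ d → ∃[ p ] FaceLength ρ d p
  faceLength-exists d =
    let k , 0<k , fix = periodic-point φ faceStep-injective encode encode-injective d
    in minimal-period φ _≟ᴰ_ 0<k fix

  sumDarts-faceStep : ∀ f → sumDarts (λ d → f (φ d)) ≡ sumDarts f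
  sumDarts-faceStep f = begin
    ∑[ u < 8 ] ∑[ v < 8 ] f (v , R v u) ≡⟨ ∑-comm (λ u v → f (v , R v u)) ⟩
    ∑[ v < 8 ] ∑[ u < 8 ] f (v , R v u) ≡⟨ sum-cong-≗ (λ v → sum-permute (λ w → f (v , w)) (rot ρ v)) ⟨
    sumDarts f                          ∎

  sumDarts-iter : ∀ k f → sumDarts (λ d → f (iter φ k d)) ≡ sumDarts f
  sumDarts-iter zero    f = refl
  sumDarts-iter (suc k) f = trans (sumDarts-iter k (f ∘ φ)) (sumDarts-faceStep f)

  opaque
    unfolding isFaceRep?

    faceCount-sumDarts : faceCount ρ ≡ sumDarts (λ d → 𝟙[ isFaceRep? ρ d ])
    faceCount-sumDarts = trans (length-filter-𝟙 (isFaceRep? ρ) allDarts)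
                               (sum-cartesianProduct (λ d → 𝟙[ isFaceRep? ρ d ]) (allFin 8) (allFin 8))

  module Face {d L} (face : FaceLength ρ d L) where
    private
      instance
        L-nonZero : NonZero L
        L-nonZero = >-nonZero (proj₁ face)
      fix : iter φ L d ≡ d
      fix = proj₁ (proj₂ face)

    sameFace? : ∀ e → Dec (SameFace ρ d e)
    sameFace? e = map′ (λ (k , _ , eq) → k , eq) (reaches-within φ fix) (anyUpTo? (λ k → iter φ k d ≟ᴰ e) L)

    face-visits : ∀ e → ∑[ j < L ] 𝟙[ iter φ (toℕ j) d ≟ᴰ e ] ≡ 𝟙[ sameFace? e ]
    face-visits e = count (sameFace? e)
      where
      count : (s : Dec (SameFace ρ d e)) → ∑[ j < L ] 𝟙[ iter φ (toℕ j) d ≟ᴰ e ] ≡ 𝟙[ s ]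
      count (no off) =
        trans (sum-cong-≗ {L} λ j → 𝟙-no (iter φ (toℕ j) d ≟ᴰ e) λ eq → off (toℕ j , eq)) (sum-replicate-zero L)
      count (yes on) with reaches-within φ fix on
      ... | k , k<L , eq =
        trans (sum-cong-≗ {L} λ j → 𝟙-cong (iter φ (toℕ j) d ≟ᴰ e) (k′ ≟ j) (mk⇔ (to j) (from j))) (∑-𝟙-≟ k′)
        where
        k′ : Fin L
        k′ = fromℕ< k<L
        to : ∀ j → iter φ (toℕ j) d ≡ e → k′ ≡ j
        to j eq′ = toℕ-injective (trans (toℕ-fromℕ< k<L)
                     (sym (period-injective φ faceStep-injective face (toℕ<n j) k<L (trans eq′ (sym eq)))))
        from : ∀ j → k′ ≡ j → iter φ (toℕ j) d ≡ e
        from j refl = trans (cong (λ n → iter φ n d) (toℕ-fromℕ< k<L)) eq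

    face-size : sumDarts (λ e → 𝟙[ sameFace? e ]) ≡ L
    face-size = begin
      sumDarts (λ e → 𝟙[ sameFace? e ])
        ≡⟨ sumDarts-cong face-visits ⟨
      sumDarts (λ e → ∑[ j < L ] 𝟙[ iter φ (toℕ j) d ≟ᴰ e ])
        ≡⟨ sumDarts-∑ {L} (λ j e → 𝟙[ iter φ (toℕ j) d ≟ᴰ e ]) ⟩
      ∑[ j < L ] sumDarts (λ e → 𝟙[ iter φ (toℕ j) d ≟ᴰ e ])
        ≡⟨ sum-cong-≗ {L} (λ j → sumDarts-𝟙-≟ (iter φ (toℕ j) d)) ⟩
      ∑[ j < L ] 1
        ≡⟨ ∑-1 L ⟩
      L ∎

    private
      least-code : ∃[ m ] SameFace ρ d m × (∀ {e} → SameFace ρ d e → code m ≤ code e)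
      least-code with least-witness (λ c → anyUpTo? (λ k → code (iter φ k d) ℕ.≟ c) L) (0 , proj₁ face , refl)
      ... | _ , (k , _ , refl) , least = iter φ k d , (k , refl) , λ on →
        let j , j<L , eq = reaches-within φ fix on in ≮⇒≥ λ smaller → least smaller (j , j<L , cong code eq)

    faceRep : Dart
    faceRep = proj₁ least-code

    faceRep-onFace : SameFace ρ d faceRep
    faceRep-onFace = proj₁ (proj₂ least-code)

    faceRep-isRep : IsRep ρ faceRep
    faceRep-isRep k = proj₂ (proj₂ least-code) (reaches-trans φ faceRep-onFace (toℕ k , refl))

    isRep-unique : L ≤ 56 → ∀ {e} → SameFace ρ d e → IsRep ρ e → e ≡ faceRep
    isRep-unique L≤56 {e} on rep
      with reaches-within φ (reaches-period φ fix on) (reaches-trans φ (reaches-sym φ fix on) faceRep-onFace)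
    ... | K , K<L , eq = code-injective (≤-antisym e≤rep (proj₂ (proj₂ least-code) on))
      where
      K<56 = <-≤-trans K<L L≤56
      e≤rep : code e ≤ code faceRep
      e≤rep = subst (λ x → code e ≤ code x) (trans (cong (λ n → iter φ n e) (toℕ-fromℕ< K<56)) eq) (rep (fromℕ< K<56))

    isFaceRep-onFace : L ≤ 56 → IsDart d → ∀ {e} → SameFace ρ d e → 𝟙[ isFaceRep? ρ e ] ≡ 𝟙[ faceRep ≟ᴰ e ]
    isFaceRep-onFace L≤56 dart {e} on = 𝟙-cong (isFaceRep? ρ e) (faceRep ≟ᴰ e) (mk⇔
      (λ (_ , rep) → sym (isRep-unique L≤56 on rep))
      (λ { refl → onFace-isDart dart faceRep-onFace , faceRep-isRep }))

    one-rep-per-face : L ≤ 56 → IsDart d → ∑[ j < L ] 𝟙[ isFaceRep? ρ (iter φ (toℕ j) d) ] ≡ 1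
    one-rep-per-face L≤56 dart = begin
      ∑[ j < L ] 𝟙[ isFaceRep? ρ (iter φ (toℕ j) d) ]
        ≡⟨ sum-cong-≗ {L} (λ j → isFaceRep-onFace L≤56 dart {iter φ (toℕ j) d} (toℕ j , refl)) ⟩
      ∑[ j < L ] 𝟙[ faceRep ≟ᴰ iter φ (toℕ j) d ]
        ≡⟨ sum-cong-≗ {L} (λ j → 𝟙-≟ᴰ-sym faceRep (iter φ (toℕ j) d)) ⟩
      ∑[ j < L ] 𝟙[ iter φ (toℕ j) d ≟ᴰ faceRep ]
        ≡⟨ face-visits faceRep ⟩
      𝟙[ sameFace? faceRep ]
        ≡⟨ 𝟙-yes (sameFace? faceRep) faceRep-onFace ⟩
      1 ∎

-- The exceptional face is a pentagon

NearlyTriangularAt : Rotation → Dart → Set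
NearlyTriangularAt ρ d₀ = ∀ d → IsDart d → SameFace ρ d₀ d ⊎ FaceLength ρ d 3

-- Double counting: summed over all darts, reps is three times the number of faces, while pointwise
-- it is 1 off the exceptional face (which is then a triangle) and hits d on it.
module _ (ρ : Rotation) (faces : faceCount ρ ≡ 18) {d₀ p} (dart₀ : IsDart d₀) (nt : NearlyTriangularAt ρ d₀)
         (face : FaceLength ρ d₀ p) where
  private
    φ = faceStep ρ
  open Face ρ face

  offFace reps hits : Dart → ℕ
  offFace d = 𝟙[ isDart? d ×-dec ¬? (sameFace? d) ]
  reps    d = ∑[ j < 3 ] 𝟙[ isFaceRep? ρ (iter φ (toℕ j) d) ]
  hits    d = ∑[ j < 3 ] 𝟙[ faceRep ≟ᴰ iter φ (toℕ j) d ]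

  isDart-split : ∀ d → 𝟙[ isDart? d ] ≡ offFace d + 𝟙[ sameFace? d ]
  isDart-split d = split (isDart? d) (sameFace? d)
    where
    split : (a : Dec (IsDart d)) (s : Dec (SameFace ρ d₀ d)) → 𝟙[ a ] ≡ 𝟙[ a ×-dec ¬? s ] + 𝟙[ s ]
    split (yes _)      (yes _)  = refl
    split (yes _)      (no _)   = refl
    split (no nonDart) (yes on) = ⊥-elim (nonDart (onFace-isDart ρ dart₀ on))
    split (no _)       (no _)   = refl

  offFace-count-length : sumDarts offFace + p ≡ 56
  offFace-count-length = begin
    sumDarts offFace + p                                 ≡⟨ cong (sumDarts offFace +_) face-size ⟨
    sumDarts offFace + sumDarts (λ d → 𝟙[ sameFace? d ]) ≡⟨ sumDarts-+ offFace (λ d → 𝟙[ sameFace? d ]) ⟨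
    sumDarts (λ d → offFace d + 𝟙[ sameFace? d ])        ≡⟨ sumDarts-cong isDart-split ⟨
    sumDarts (λ d → 𝟙[ isDart? d ])                      ≡⟨⟩
    56                                                   ∎

  exceptional-face-≤56 : p ≤ 56
  exceptional-face-≤56 = subst (p ≤_) offFace-count-length (m≤n+m p (sumDarts offFace))

  reps-split : ∀ d → reps d ≡ offFace d + hits d
  reps-split d = split (isDart? d) (sameFace? d)
    where
    split : (a : Dec (IsDart d)) (s : Dec (SameFace ρ d₀ d)) → reps d ≡ 𝟙[ a ×-dec ¬? s ] + hits d
    split (no nonDart) _ =
      trans (sum-cong-≗ {3} λ j → 𝟙-no (isFaceRep? ρ (iter φ (toℕ j) d)) (nonDart′ j ∘ proj₁))
            (sym (sum-cong-≗ {3} λ j → 𝟙-no (faceRep ≟ᴰ iter φ (toℕ j) d)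
                                         λ eq → nonDart′ j (subst IsDart eq (onFace-isDart ρ dart₀ faceRep-onFace))))
      where
      nonDart′ : ∀ j → ¬ IsDart (iter φ (toℕ j) d)
      nonDart′ j = iter-preserves φ {¬_ ∘ IsDart} (faceStep-nonDart ρ) (toℕ j) nonDart
    split (yes _) (yes on) = sum-cong-≗ {3} λ j →
      isFaceRep-onFace exceptional-face-≤56 dart₀ {iter φ (toℕ j) d} (reaches-trans φ on (toℕ j , refl))
    split (yes dart) (no off) = [ ⊥-elim ∘ off , on-triangle ]′ (nt d dart)
      where
      on-triangle : FaceLength ρ d 3 → reps d ≡ 1 + hits d
      on-triangle triangle =
        trans (Face.one-rep-per-face ρ triangle (m≤m+n 3 53) dart)
              (sym (cong suc (sum-cong-≗ {3} λ j → 𝟙-no (faceRep ≟ᴰ iter φ (toℕ j) d) (off ∘ on j))))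
        where
        on : ∀ j → faceRep ≡ iter φ (toℕ j) d → SameFace ρ d₀ d
        on j eq = reaches-trans φ faceRep-onFace (reaches-sym φ {3} {d} (proj₁ (proj₂ triangle)) (toℕ j , sym eq))

  reps-count : sumDarts reps ≡ 54
  reps-count = begin
    sumDarts reps
      ≡⟨ sumDarts-∑ {3} (λ j d → 𝟙[ isFaceRep? ρ (iter φ (toℕ j) d) ]) ⟩
    ∑[ j < 3 ] sumDarts (λ d → 𝟙[ isFaceRep? ρ (iter φ (toℕ j) d) ])
      ≡⟨ sum-cong-≗ {3} (λ j → sumDarts-iter ρ (toℕ j) (λ d → 𝟙[ isFaceRep? ρ d ])) ⟩
    ∑[ j < 3 ] sumDarts (λ d → 𝟙[ isFaceRep? ρ d ])
      ≡⟨ sum-cong-≗ {3} (λ _ → trans (sym (faceCount-sumDarts ρ)) faces) ⟩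
    54 ∎

  hits-count : sumDarts hits ≡ 3
  hits-count = begin
    sumDarts hits
      ≡⟨ sumDarts-∑ {3} (λ j d → 𝟙[ faceRep ≟ᴰ iter φ (toℕ j) d ]) ⟩
    ∑[ j < 3 ] sumDarts (λ d → 𝟙[ faceRep ≟ᴰ iter φ (toℕ j) d ])
      ≡⟨ sum-cong-≗ {3} (λ j → trans (sumDarts-iter ρ (toℕ j) (λ d → 𝟙[ faceRep ≟ᴰ d ])) (sumDarts-𝟙-≟ faceRep)) ⟩
    3 ∎

  offFace-count : sumDarts offFace ≡ 51
  offFace-count = +-cancelʳ-≡ 3 (sumDarts offFace) 51 (begin
    sumDarts offFace + 3                ≡⟨ cong (sumDarts offFace +_) hits-count ⟨
    sumDarts offFace + sumDarts hits    ≡⟨ sumDarts-+ offFace hits ⟨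
    sumDarts (λ d → offFace d + hits d) ≡⟨ sumDarts-cong reps-split ⟨
    sumDarts reps                       ≡⟨ reps-count ⟩
    54                                  ∎)

  exceptional-face-length : p ≡ 5
  exceptional-face-length = +-cancelˡ-≡ 51 p 5 (begin
    51 + p               ≡⟨ cong (_+ p) offFace-count ⟨
    sumDarts offFace + p ≡⟨ offFace-count-length ⟩
    56                   ∎)

-- Pentagonal near triangulations

next : Fin 5 → Fin 5
next 0F = 1F
next 1F = 2F
next 2F = 3F
next 3F = 4F
next 4F = 0F

cyclic-distance : ∀ i j → i ≡ j ⊎ j ≡ next i ⊎ j ≡ next (next i) ⊎ i ≡ next j ⊎ i ≡ next (next j)
cyclic-distance = from-yes (all? λ i → all? λ j →
  i ≟ j ⊎-dec j ≟ next i ⊎-dec j ≟ next (next i) ⊎-dec i ≟ next j ⊎-dec i ≟ next (next j))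

PentagonDart : (Fin 5 → Fin 8) → Fin 8 → Fin 8 → Set
PentagonDart x u v = ∃[ i ] u ≡ x i × v ≡ x (next i)

pentagonDart? : ∀ x u v → Dec (PentagonDart x u v)
pentagonDart? x u v = any? λ i → u ≟ x i ×-dec v ≟ x (next i)

-- R v u is the successor of u in the rotation at v.  Of the rotations being 7-cycles, only the
-- consequences used by the search are recorded.
record NearTriangulation (R : Table) (x : Fin 5 → Fin 8) : Set where
  field
    centre-fixed : ∀ v → R v v ≡ v
    injective    : ∀ v → Injective _≡_ _≡_ (R v)
    long-cycles  : ∀ v {u} → u ≢ v → ∀ k → 0 < k → k < 7 → iter (R v) k u ≢ u
    pentagon     : ∀ i → R (x (next i)) (x i) ≡ x (next (next i))
    triangle     : ∀ {u v} → u ≢ v → ¬ PentagonDart x u v → R (R v u) v ≡ u × R u (R v u) ≡ v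

  successor-≢ : ∀ {v u} → u ≢ v → R v u ≢ v
  successor-≢ {v} u≢v eq = u≢v (injective v (trans eq (sym (centre-fixed v))))

  successor-≢-self : ∀ {v u} → u ≢ v → R v u ≢ u
  successor-≢-self {v} u≢v = long-cycles v u≢v 1 z<s (s<s z<s)

standardPentagon : Fin 5 → Fin 8
standardPentagon i = i ↑ˡ 3

pentagonOf : Rotation → Dart → Fin 5 → Fin 8
pentagonOf ρ d₀ i = proj₁ (iter (faceStep ρ) (toℕ i) d₀)

module _ (ρ : Rotation) {d₀} (dart₀ : IsDart d₀) (pentagon : FaceLength ρ d₀ 5) where
  private
    φ = faceStep ρ
    R = table ρ
    x = pentagonOf ρ d₀
    closes : iter φ 5 d₀ ≡ d₀
    closes = proj₁ (proj₂ pentagon)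

  pentagon-dart : ∀ i → iter φ (toℕ i) d₀ ≡ (x i , x (next i))
  pentagon-dart 0F = refl
  pentagon-dart 1F = refl
  pentagon-dart 2F = refl
  pentagon-dart 3F = refl
  pentagon-dart 4F = cong (λ d → x 4F , proj₁ d) closes

  faceStep-pentagon : ∀ i → φ (x i , x (next i)) ≡ (x (next i) , x (next (next i)))
  faceStep-pentagon i = trans (cong φ (sym (pentagon-dart i))) (trans (advance i) (pentagon-dart (next i)))
    where
    advance : ∀ i → φ (iter φ (toℕ i) d₀) ≡ iter φ (toℕ (next i)) d₀
    advance 0F = refl
    advance 1F = refl
    advance 2F = refl
    advance 3F = refl
    advance 4F = closes

  pentagon-successor : ∀ i → R (x (next i)) (x i) ≡ x (next (next i))
  pentagon-successor i = cong proj₂ (faceStep-pentagon i)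

  pentagon-edge : ∀ i → x i ≢ x (next i)
  pentagon-edge i = subst IsDart (pentagon-dart i) (iter-preserves φ {IsDart} (faceStep-isDart ρ) (toℕ i) dart₀)

  pentagon-diagonal : ∀ i → x i ≢ x (next (next i))
  pentagon-diagonal i eq = table-long-cycles ρ (x (next i)) (pentagon-edge i) 1 z<s (s<s z<s)
                             (trans (pentagon-successor i) (sym eq))

  pentagon-injective : Injective _≡_ _≡_ (pentagonOf ρ d₀)
  pentagon-injective {i} {j} eq with cyclic-distance i j
  ... | inj₁ i≡j                       = i≡j
  ... | inj₂ (inj₁ refl)               = ⊥-elim (pentagon-edge i eq)
  ... | inj₂ (inj₂ (inj₁ refl))        = ⊥-elim (pentagon-diagonal i eq)
  ... | inj₂ (inj₂ (inj₂ (inj₁ refl))) = ⊥-elim (pentagon-edge j (sym eq))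
  ... | inj₂ (inj₂ (inj₂ (inj₂ refl))) = ⊥-elim (pentagon-diagonal j (sym eq))

  module _ (nt : NearlyTriangularAt ρ d₀) where

    off-pentagon-triangle : ∀ {u v} → u ≢ v → ¬ PentagonDart x u v → R (R v u) v ≡ u × R u (R v u) ≡ v
    off-pentagon-triangle {u} {v} u≢v off = [ ⊥-elim ∘ off ∘ onPentagon , equations ]′ (nt (u , v) u≢v)
      where
      onPentagon : SameFace ρ d₀ (u , v) → PentagonDart x u v
      onPentagon on =
        let k , k<5 , eq = reaches-within φ closes on
            i = fromℕ< k<5
        in i , ×-≡,≡←≡ (begin
          (u , v)            ≡⟨ eq ⟨
          iter φ k d₀        ≡⟨ cong (λ n → iter φ n d₀) (toℕ-fromℕ< k<5) ⟨
          iter φ (toℕ i) d₀  ≡⟨ pentagon-dart i ⟩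
          (x i , x (next i)) ∎)
      equations : FaceLength ρ (u , v) 3 → R (R v u) v ≡ u × R u (R v u) ≡ v
      equations (_ , closes₃ , _) =
        cong proj₁ closes₃ , trans (cong (λ w → R w (R v u)) (sym (cong proj₁ closes₃))) (cong proj₂ closes₃)

    near-triangulation : NearTriangulation (table ρ) (pentagonOf ρ d₀)
    near-triangulation = record
      { centre-fixed = fixes ρ
      ; injective    = table-injective ρ
      ; long-cycles  = table-long-cycles ρ
      ; pentagon     = pentagon-successor
      ; triangle     = off-pentagon-triangle
      }

conjugate : Permutation′ 8 → Table → Table
conjugate π R v u = π ⟨$⟩ʳ R (π ⟨$⟩ˡ v) (π ⟨$⟩ˡ u)

relabel : ∀ {R x y} (π : Permutation′ 8) → NearTriangulation R x → (∀ i → π ⟨$⟩ʳ x i ≡ y i) →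
          NearTriangulation (conjugate π R) y
relabel {R} {x} {y} π N πx≡y = record
  { centre-fixed = λ v → trans (cong (π ⟨$⟩ʳ_) (centre-fixed (π ⟨$⟩ˡ v))) (inverseʳ π)
  ; injective    = λ v → π⁻¹-injective ∘ injective (π ⟨$⟩ˡ v) ∘ π-injective
  ; long-cycles  = λ v u≢v k 0<k k<7 cycle → long-cycles (π ⟨$⟩ˡ v) (u≢v ∘ π⁻¹-injective) k 0<k k<7
                     (trans (sym (inverseˡ π)) (cong (π ⟨$⟩ˡ_) (trans (sym (iter-conjugate v k _)) cycle)))
  ; pentagon     = λ i → trans (cong (π ⟨$⟩ʳ_) (trans (cong₂ R (π⁻¹y≡x (next i)) (π⁻¹y≡x i)) (pentagon i)))
                               (πx≡y (next (next i)))
  ; triangle     = triangle′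
  }
  where
  open NearTriangulation N
  π-injective : Injective _≡_ _≡_ (π ⟨$⟩ʳ_)
  π-injective = Injection.injective (↔⇒↣ π)
  π⁻¹-injective : Injective _≡_ _≡_ (π ⟨$⟩ˡ_)
  π⁻¹-injective = Injection.injective (↔⇒↣ (flip π))
  π⁻¹y≡x : ∀ i → π ⟨$⟩ˡ y i ≡ x i
  π⁻¹y≡x i = trans (cong (π ⟨$⟩ˡ_) (sym (πx≡y i))) (inverseˡ π)

  iter-conjugate : ∀ v k u → iter (conjugate π R v) k u ≡ π ⟨$⟩ʳ iter (R (π ⟨$⟩ˡ v)) k (π ⟨$⟩ˡ u)
  iter-conjugate v 0       u = sym (inverseʳ π)
  iter-conjugate v (suc k) u = cong (λ z → π ⟨$⟩ʳ R (π ⟨$⟩ˡ v) (π ⟨$⟩ˡ z)) (iter-conjugate v k u)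
                               ∙ cong (λ z → π ⟨$⟩ʳ R (π ⟨$⟩ˡ v) z) (inverseˡ π)
    where _∙_ = trans

  triangle′ : ∀ {u v} → u ≢ v → ¬ PentagonDart y u v →
              conjugate π R (conjugate π R v u) v ≡ u × conjugate π R u (conjugate π R v u) ≡ v
  triangle′ {u} {v} u≢v off =
      trans (cong (λ z → π ⟨$⟩ʳ R z (π ⟨$⟩ˡ v)) (inverseˡ π)) (trans (cong (π ⟨$⟩ʳ_) (proj₁ t)) (inverseʳ π))
    , trans (cong (λ z → π ⟨$⟩ʳ R (π ⟨$⟩ˡ u) z) (inverseˡ π)) (trans (cong (π ⟨$⟩ʳ_) (proj₂ t)) (inverseʳ π))
    where
    off′ : ¬ PentagonDart x (π ⟨$⟩ˡ u) (π ⟨$⟩ˡ v)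
    off′ (i , u′≡xi , v′≡xi′) = off (i , back u′≡xi (πx≡y i) , back v′≡xi′ (πx≡y (next i)))
      where
      back : ∀ {w a b} → π ⟨$⟩ˡ w ≡ a → π ⟨$⟩ʳ a ≡ b → w ≡ b
      back eq₁ eq₂ = trans (sym (inverseʳ π)) (trans (cong (π ⟨$⟩ʳ_) eq₁) eq₂)
    t = triangle (u≢v ∘ π⁻¹-injective) off′

-- The exhaustive search

PartialTable : Set
PartialTable = Vec (Vec (Maybe (Fin 8)) 8) 8

entry : PartialTable → Fin 8 → Fin 8 → Maybe (Fin 8)
entry P v u = lookup (lookup P v) u

setEntry : PartialTable → Fin 8 → Fin 8 → Fin 8 → PartialTable
setEntry P v u w = P [ v ]%= (_[ u ]≔ just w)

empty : PartialTable
empty = replicate 8 (replicate 8 nothing)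

Extends : Table → PartialTable → Set
Extends R P = ∀ v u {w} → entry P v u ≡ just w → R v u ≡ w

returnsWithin : ℕ → PartialTable → Fin 8 → Fin 8 → Fin 8 → Bool
returnsWithin n P v u z with z ≟ u | n | entry P v z
... | yes _ | _     | _       = true
... | no _  | suc m | just z′ = returnsWithin m P v u z′
... | no _  | _     | _       = false

assign : PartialTable → Fin 8 → Fin 8 → Fin 8 → Maybe PartialTable
assign P v u w with entry P v u
... | just w′ = if does (w′ ≟ w) then just P else nothing
... | nothing with w ≟ v | any? (λ u′ → ≡-dec-Maybe _≟_ (entry P v u′) (just w)) | returnsWithin 5 P v u w
...   | no _ | no _ | false = just (setEntry P v u w)
...   | _    | _    | _     = nothing

addTriangle : PartialTable → Fin 8 → Fin 8 → Fin 8 → Maybe PartialTable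
addTriangle P u v w = assign P v u w >>= λ P₁ → assign P₁ w v u >>= λ P₂ → assign P₂ u w v

Open : PartialTable → Fin 8 → Fin 8 → Set
Open P u v = entry P v u ≡ nothing × u ≢ v × ¬ PentagonDart standardPentagon u v

open? : ∀ P u v → Dec (Open P u v)
open? P u v = ≡-dec-Maybe _≟_ (entry P v u) nothing ×-dec ¬? (u ≟ v) ×-dec ¬? (pentagonDart? standardPentagon u v)

openDart? : ∀ P → Dec (∃[ u ] ∃[ v ] Open P u v)
openDart? P = any? λ u → any? λ v → open? P u v

refute : ℕ → PartialTable → Bool
refuteAt : ℕ → ∀ P → Dec (∃[ u ] ∃[ v ] Open P u v) → Bool

refute zero    P = false
refute (suc n) P = refuteAt n P (openDart? P)

refuteAt n P (no _)            = false
refuteAt n P (yes (u , v , _)) = isYes (all? λ w → maybe′ (refute n) true (addTriangle P u v w) ≟ᵇ true)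

addPentagonCorner : Fin 5 → Maybe PartialTable → Maybe PartialTable
addPentagonCorner i m = m >>= λ P → assign P (x (next i)) (x i) (x (next (next i)))
  where x = standardPentagon

initial : Maybe PartialTable
initial = foldr addPentagonCorner (just empty) (allFin 5)

-- Each round fills at least one of the 56 entries, so 60 rounds never run out.
search-refutes : maybe′ (refute 60) true initial ≡ true
search-refutes = refl

standardPentagon-edge : ∀ i → standardPentagon i ≢ standardPentagon (next i)
standardPentagon-edge 0F ()
standardPentagon-edge 1F ()
standardPentagon-edge 2F ()
standardPentagon-edge 3F ()
standardPentagon-edge 4F ()

entry-setEntry : ∀ P v u w → entry (setEntry P v u w) v u ≡ just w
entry-setEntry P v u w = begin
  lookup (lookup (P [ v ]%= (_[ u ]≔ just w)) v) u ≡⟨ cong (λ row → lookup row u) (lookup∘updateAt v P) ⟩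
  lookup (lookup P v [ u ]≔ just w) u               ≡⟨ lookup∘update u (lookup P v) (just w) ⟩
  just w                                            ∎

entry-setEntry-row : ∀ P {v a} u w b → a ≢ v → entry (setEntry P v u w) a b ≡ entry P a b
entry-setEntry-row P {v} {a} u w b a≢v = cong (λ row → lookup row b) (lookup∘updateAt′ a v a≢v P)

entry-setEntry-column : ∀ P v {u b} w → b ≢ u → entry (setEntry P v u w) v b ≡ entry P v b
entry-setEntry-column P v {u} {b} w b≢u =
  trans (cong (λ row → lookup row b) (lookup∘updateAt v P)) (lookup∘update′ b≢u (lookup P v) (just w))

module _ {R : Table} where

  empty-extends : Extends R empty
  empty-extends v u eq with trans (sym (lookup-replicate u nothing))
                                  (trans (cong (λ row → lookup row u) (sym (lookup-replicate v _))) eq)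
  ... | ()

  setEntry-extends : ∀ {P v u w} → Extends R P → R v u ≡ w → Extends R (setEntry P v u w)
  setEntry-extends {P} {v} {u} {w} ext Rvu≡w a b eq with a ≟ v | b ≟ u
  ... | no a≢v    | _         = ext a b (trans (sym (entry-setEntry-row P u w b a≢v)) eq)
  ... | yes refl  | no b≢u    = ext a b (trans (sym (entry-setEntry-column P v w b≢u)) eq)
  ... | yes refl  | yes refl  = trans Rvu≡w (just-injective (trans (sym (entry-setEntry P v u w)) eq))

  >>=-extends : ∀ {m f} → Any (Extends R) m → (∀ {P} → Extends R P → Any (Extends R) (f P)) →
                Any (Extends R) (m >>= f)
  >>=-extends (just ext) k = k ext

module Soundness {R : Table} (N : NearTriangulation R standardPentagon) where
  open NearTriangulation N

  returnsWithin-sound : ∀ {P v u} → Extends R P → u ≢ v → ∀ n k z → z ≡ iter (R v) k u →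
                        0 < k → k + n < 7 → returnsWithin n P v u z ≡ true → ⊥
  returnsWithin-sound {P} {v} {u} ext u≢v n k z z≡ 0<k bound returns with z ≟ u | n | entry P v z in eq
  ... | yes z≡u | n′    | _       = long-cycles v u≢v k 0<k (≤-<-trans (m≤m+n k n′) bound) (trans (sym z≡) z≡u)
  ... | no _    | suc m | just z′ =
    returnsWithin-sound ext u≢v m (suc k) z′ (trans (sym (ext v z eq)) (cong (R v) z≡)) z<s
                        (subst (_< 7) (+-suc k m) bound) returns

  assign-sound : ∀ {P v u w} → Extends R P → u ≢ v → R v u ≡ w → Any (Extends R) (assign P v u w)
  assign-sound {P} {v} {u} {w} ext u≢v Rvu≡w with entry P v u in eq
  ... | just w′ with w′ ≟ w
  ...   | yes _   = just ext
  ...   | no w′≢w = ⊥-elim (w′≢w (trans (sym (ext v u eq)) Rvu≡w))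
  assign-sound {P} {v} {u} {w} ext u≢v Rvu≡w | nothing
    with w ≟ v | any? (λ u′ → ≡-dec-Maybe _≟_ (entry P v u′) (just w)) | returnsWithin 5 P v u w in returns
  ... | yes w≡v | _               | _     = ⊥-elim (successor-≢ u≢v (trans Rvu≡w w≡v))
  ... | no _    | yes (u′ , eq′)  | _     with injective v (trans (ext v u′ eq′) (sym Rvu≡w))
  ...   | refl with trans (sym eq) eq′
  ...     | ()
  assign-sound ext u≢v Rvu≡w | nothing | no _ | no _ | true =
    ⊥-elim (returnsWithin-sound ext u≢v 5 1 _ (sym Rvu≡w) z<s (n<1+n 6) returns)
  assign-sound {P} ext u≢v Rvu≡w | nothing | no _ | no _ | false = just (setEntry-extends {P = P} ext Rvu≡w)

  addTriangle-sound : ∀ {P u v} → Extends R P → u ≢ v → ¬ PentagonDart standardPentagon u v →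
                      Any (Extends R) (addTriangle P u v (R v u))
  addTriangle-sound {P} ext u≢v off =
    >>=-extends (assign-sound {P} ext u≢v refl) λ {P₁} ext₁ →
    >>=-extends (assign-sound {P₁} ext₁ (λ eq → successor-≢ u≢v (sym eq)) (proj₁ (triangle u≢v off))) λ {P₂} ext₂ →
    assign-sound {P₂} ext₂ (successor-≢-self u≢v) (proj₂ (triangle u≢v off))

  refute-sound : ∀ n {P} → Extends R P → refute n P ≡ true → ⊥
  refuteAt-sound : ∀ n {P} (found : Dec (∃[ u ] ∃[ v ] Open P u v)) → Extends R P → refuteAt n P found ≡ true → ⊥

  refute-sound zero    _ ()
  refute-sound (suc n) {P} = refuteAt-sound n {P} (openDart? P)

  refuteAt-sound n (no _) _ ()

  refuteAt-sound n {P} (yes (u , v , _ , u≢v , off)) ext refuted =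
    branch-sound (addTriangle-sound {P} ext u≢v off) (every-branch-refuted (R v u))
    where
    every-branch-refuted : ∀ w → maybe′ (refute n) true (addTriangle P u v w) ≡ true
    every-branch-refuted = toWitness (Equivalence.from T-≡ refuted)
    branch-sound : ∀ {m} → Any (Extends R) m → maybe′ (refute n) true m ≡ true → ⊥
    branch-sound {just P′} (just ext′) = refute-sound n {P′} ext′

  initial-sound : Any (Extends R) initial
  initial-sound = corners (allFin 5)
    where
    corners : ∀ is → Any (Extends R) (foldr addPentagonCorner (just empty) is)
    corners []       = just empty-extends
    corners (i ∷ is) = >>=-extends (corners is) λ {P} ext → assign-sound {P} ext (standardPentagon-edge i) (pentagon i)

no-standard-near-triangulation : ∀ {R} → NearTriangulation R standardPentagon → ⊥
no-standard-near-triangulation {R} N = refuted initial-sound search-refutes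
  where
  open Soundness N
  refuted : ∀ {m} → Any (Extends R) m → maybe′ (refute 60) true m ≡ true → ⊥
  refuted {just P} (just ext) = refute-sound 60 {P} ext

genus-two-faceCount : ∀ ρ → HasGenus ρ 2 → faceCount ρ ≡ 18
genus-two-faceCount ρ genus = ℤ.+-injective (∙-cancelˡ ℤ.-[1+ 19 ] (ℤ.+ faceCount ρ) (ℤ.+ 18) genus)

-- A non-dart is fixed by faceStep, so if the given d₀ is one, every dart lies on a triangle.
genuine-exceptional-dart : ∀ ρ → NearlyTriangular ρ → ∃[ d₀ ] IsDart d₀ × NearlyTriangularAt ρ d₀
genuine-exceptional-dart ρ (d₀ , nt) with isDart? d₀
... | yes dart₀   = d₀ , dart₀ , nt
... | no nonDart₀ = (0F , 1F) , (λ ()) , λ d dart → [ ⊥-elim ∘ (λ on → off on dart) , inj₂ ]′ (nt d dart)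
  where
  off : ∀ {d} → SameFace ρ d₀ d → ¬ IsDart d
  off (k , refl) = iter-preserves (faceStep ρ) {¬_ ∘ IsDart} (faceStep-nonDart ρ) k nonDart₀

mainTheorem20 : (ρ : Rotation) → HasGenus ρ 2 → ¬ NearlyTriangular ρ
mainTheorem20 ρ genus nearly =
  let d₀ , dart₀ , nt = genuine-exceptional-dart ρ nearly
      p , face        = faceLength-exists ρ d₀
      pentagon        = subst (FaceLength ρ d₀) (exceptional-face-length ρ (genus-two-faceCount ρ genus) dart₀ nt face)
                                face
      π , normalised  = permutation-mapping (pentagonOf ρ d₀) standardPentagon
                          (pentagon-injective ρ dart₀ pentagon) (λ {i} {j} → ↑ˡ-injective 3 i j)
  in no-standard-near-triangulation
       (relabel {x = pentagonOf ρ d₀} π (near-triangulation ρ dart₀ pentagon nt) normalised)
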